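{- Let $n\ge4$. The length of $w_n\in W(D_n)$ is $\ell(w_n)=\frac{3n^2}{8}+\frac n4$ if $n$ is even and $\ell(w_n)=\frac{3(n-1)^2}{8}+\frac{n-1}{4}$ if $n$ is odd.
   Context: $W(D_n)$ is the Coxeter group with generators $s_1,\dots,s_n$, where $s_1s_3$, $s_2s_3$, $s_is_{i+1}$ ($3\le i\le n-1$) have order 3 and all other pairs of distinct generators commute, realized as signed permutations of $\{\pm1,\dots,\pm n\}$ with an even number of sign changes via $s_1\mapsto(1,-2)(-1,2)$, $s_i\mapsto(i-1,i)(-(i-1),-i)$ ($i\ge2$), products being compositions of functions; $\ell$ is the Coxeter length. For even $n$, $w_n(1)=(-1)^{n/2}$, $w_n(i)=i$ for odd $i>1$, $w_n(i)=-(n+2-i)$ for even $i$. For odd $n$, $w_n(1)=(-1)^{(n-1)/2}$, $w_n(i)=i$ for odd $i>1$, $w_n(i)=-(n+1-i)$ for even $i$ (so $w_n(n)=n$). -}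

module Defs where

open import Data.Nat using (ℕ; zero; suc; _+_; _*_; _∸_; _≤_; _/_; _%_)
open import Data.Integer as ℤ using (ℤ; +_; -_)
import Data.Integer.Properties as ℤP
open import Data.Fin using (Fin; toℕ)
open import Data.List using (List; []; _∷_; length)
open import Data.Product using (Σ; _×_; _,_)
open import Relation.Nullary using (yes; no)
open import Relation.Binary.PropositionalEquality using (_≡_)

-- Action of the Coxeter generator s_i (i = 1,…,n) of W(D_n) on signed
-- letters ±1,…,±n (represented as integers):
--   s_1 = (1,-2)(-1,2),   s_i = (i-1,i)(-(i-1),-i) for i ≥ 2.
swapPair : ℤ → ℤ → ℤ → ℤ
swapPair a b x with x ℤ.≟ a
... | yes _ = b
... | no _ with x ℤ.≟ b
...   | yes _ = a
...   | no _ = x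

genAct : ℕ → ℤ → ℤ
genAct zero x = x
genAct 1 x = swapPair (+ 1) (- (+ 2)) (swapPair (- (+ 1)) (+ 2) x)
genAct (suc (suc k)) x =
  swapPair (+ suc k) (+ suc (suc k)) (swapPair (- (+ suc k)) (- (+ suc (suc k))) x)

-- A word in the generators s_1,…,s_n of W(D_n); the letter (j : Fin n)
-- stands for s_{j+1}.
Word : ℕ → Set
Word n = List (Fin n)

-- The signed permutation s_{i1} s_{i2} ⋯ s_{ik} (composition of functions,
-- rightmost applied first) evaluated at x.
evalWord : ∀ {n} → Word n → ℤ → ℤ
evalWord [] x = x
evalWord (j ∷ ws) x = genAct (suc (toℕ j)) (evalWord ws x)

-- A word represents the element w (given by its values w(1),…,w(n);
-- a signed permutation is determined by these).
Represents : (n : ℕ) → Word n → (ℕ → ℤ) → Set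
Represents n ws w = ∀ i → 1 ≤ i → i ≤ n → evalWord ws (+ i) ≡ w i

CoxeterLength : (n : ℕ) → (ℕ → ℤ) → ℕ → Set
CoxeterLength n w L =
  Σ (Word n) (λ ws → length ws ≡ L × Represents n ws w)
  × (∀ (ws : Word n) → Represents n ws w → L ≤ length ws)

signPow : ℕ → ℤ
signPow zero = + 1
signPow (suc k) = - signPow k

wn : ℕ → ℕ → ℤ
wn n i with n % 2 | i % 2 | i
... | _ | _ | 1 = signPow (n / 2)
... | _ | 1 | _ = + i                  -- odd i > 1
... | 0 | _ | _ = - (+ (n + 2 ∸ i))    -- even i, even n
... | _ | _ | _ = - (+ (n + 1 ∸ i))    -- even i, odd n

-- For w ∈ W(D_n) let L(w) = #{i < j ∣ w(i) > w(j)} + #{i < j ∣ w(i) + w(j) < 0}. L vanishes at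
-- the identity, and a generator changes it by at most one, since it can only affect the pair of
-- positions holding the two magnitudes it moves; hence L(w) ≤ ℓ(w).
--
-- For n = 2m, w_n = A_{m-1} ⋯ A_1 A_0 with A_k = s_1 s_2 t_1 ⋯ t_k, where
-- t_i = s_{2i+1} s_{2i+2} s_{2i+1} transposes the magnitudes 2i and 2i+2. This word has length
-- ∑_{k<m} (3k + 2) = (3m² + m)/2 = (3n² + 2n)/8, and counting L(w_n) directly gives the same
-- number: in w_n, position 2i+1 holds ±(2i+1) and position 2i+2 holds -2(m-i), so the
-- contribution of a pair of positions depends only on whether i + j < m. For n = 2m+1, w_n agrees
-- with w_{2m} on 1, …, 2m and fixes n, so the same word works.

module Submission where

open import Defs
open import Data.Nat
  using (ℕ; zero; suc; _+_; _*_; _∸_; _≤_; _<_; _/_; _%_; z≤n; s≤s; s≤s⁻¹; _<?_; _⊓_)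
open import Data.Nat.Properties
open import Data.Nat.DivMod using (m*n/n≡m; m*n%n≡0; +-distrib-/; m≡m%n+[m/n]*n)
open import Data.Nat.Tactic.RingSolver using (solve-∀)
open import Data.Integer as ℤ using (ℤ; +_; -_; -[1+_]; ∣_∣)
import Data.Integer.Properties as ℤ
open import Data.Sum using (_⊎_; inj₁; inj₂)
open import Data.Product using (_×_; _,_; proj₁; proj₂; Σ)
open import Data.Empty using (⊥-elim)
open import Data.Fin using (toℕ; fromℕ<)
open import Data.Fin.Properties using (toℕ-fromℕ<)
open import Data.List using (List; []; _∷_; length; _++_; map)
open import Data.List.Properties using (length-++; length-map)
open import Data.List.Relation.Unary.All as All using (All; []; _∷_)
open import Data.List.Relation.Unary.All.Properties using (++⁺)
open import Function using (_∘_)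
open import Function.Bundles using (_⇔_; mk⇔; Equivalence)
import Function.Properties.Equivalence as ⇔
open import Relation.Nullary using (yes; no; ¬_; Dec)
open import Relation.Binary using (tri<; tri≈; tri>)
open import Relation.Binary.PropositionalEquality

double : ℕ → ℕ
double zero    = 0
double (suc m) = suc (suc (double m))

double≡2* : ∀ m → double m ≡ 2 * m
double≡2* zero    = refl
double≡2* (suc m) = trans (cong (suc ∘ suc) (double≡2* m)) (sym (lemma m))
  where
  lemma : ∀ m → 2 * suc m ≡ suc (suc (2 * m))
  lemma = solve-∀

double-mono-≤ : ∀ {m n} → m ≤ n → double m ≤ double n
double-mono-≤ z≤n       = z≤n
double-mono-≤ (s≤s m≤n) = s≤s (s≤s (double-mono-≤ m≤n))

double-mono-< : ∀ {m n} → m < n → double m < double n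
double-mono-< m<n = ≤-trans (n≤1+n _) (double-mono-≤ m<n)

double-cancel-≤ : ∀ {m n} → double m ≤ double n → m ≤ n
double-cancel-≤ {zero}  _                 = z≤n
double-cancel-≤ {suc m} {suc n} (s≤s (s≤s le)) = s≤s (double-cancel-≤ le)

suc-double≢double : ∀ i k → suc (double i) ≢ double k
suc-double≢double zero    (suc zero)    ()
suc-double≢double (suc i) (suc (suc k)) eq = suc-double≢double i (suc k) (suc-injective (suc-injective eq))

double-∸ : ∀ m k → double m ∸ double k ≡ double (m ∸ k)
double-∸ zero    k       = trans (0∸n≡0 (double k)) (cong double (sym (0∸n≡0 k)))
double-∸ (suc m) zero    = refl
double-∸ (suc m) (suc k) = double-∸ m k

double-%2 : ∀ m → double m % 2 ≡ 0
double-%2 zero    = refl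
double-%2 (suc m) = double-%2 m

suc-double-%2 : ∀ m → suc (double m) % 2 ≡ 1
suc-double-%2 zero    = refl
suc-double-%2 (suc m) = suc-double-%2 m

double-/2 : ∀ m → double m / 2 ≡ m
double-/2 m = trans (cong (_/ 2) (trans (double≡2* m) (*-comm 2 m))) (m*n/n≡m m 2)

n≡n%2+double[n/2] : ∀ n → n ≡ n % 2 + double (n / 2)
n≡n%2+double[n/2] n =
  trans (m≡m%n+[m/n]*n n 2) (cong (λ d → n % 2 + d) (trans (*-comm (n / 2) 2) (sym (double≡2* (n / 2)))))

suc-double-/2 : ∀ m → suc (double m) / 2 ≡ m
suc-double-/2 m = begin
  suc (double m) / 2   ≡⟨ cong (_/ 2) (trans (cong suc (double≡2* m)) (lemma m)) ⟩
  (m * 2 + 1) / 2      ≡⟨ +-distrib-/ (m * 2) 1 (subst (λ r → r + 1 < 2) (sym (m*n%n≡0 m 2)) ≤-refl) ⟩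
  m * 2 / 2 + 1 / 2    ≡⟨ cong (_+ 0) (m*n/n≡m m 2) ⟩
  m + 0                ≡⟨ +-identityʳ m ⟩
  m                    ∎
  where
  open ≡-Reasoning
  lemma : ∀ m → suc (2 * m) ≡ m * 2 + 1
  lemma = solve-∀

∑ : ℕ → (ℕ → ℕ) → ℕ
∑ zero    f = 0
∑ (suc n) f = ∑ n f + f n

∑-cong : ∀ n {f h : ℕ → ℕ} → (∀ i → i < n → f i ≡ h i) → ∑ n f ≡ ∑ n h
∑-cong zero    e = refl
∑-cong (suc n) e = cong₂ _+_ (∑-cong n (λ i i<n → e i (m<n⇒m<1+n i<n))) (e n ≤-refl)

∑-mono-≤ : ∀ n {f h : ℕ → ℕ} → (∀ i → i < n → f i ≤ h i) → ∑ n f ≤ ∑ n h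
∑-mono-≤ zero    e = z≤n
∑-mono-≤ (suc n) e = +-mono-≤ (∑-mono-≤ n (λ i i<n → e i (m<n⇒m<1+n i<n))) (e n ≤-refl)

∑-distrib-+ : ∀ n (f h : ℕ → ℕ) → ∑ n (λ i → f i + h i) ≡ ∑ n f + ∑ n h
∑-distrib-+ zero    f h = refl
∑-distrib-+ (suc n) f h rewrite ∑-distrib-+ n f h = lemma (∑ n f) (∑ n h) (f n) (h n)
  where
  lemma : ∀ a b c d → a + b + (c + d) ≡ a + c + (b + d)
  lemma = solve-∀

∑-const : ∀ n c → ∑ n (λ _ → c) ≡ n * c
∑-const zero    c = refl
∑-const (suc n) c rewrite ∑-const n c = +-comm (n * c) c

∑-zero : ∀ n {f : ℕ → ℕ} → (∀ i → i < n → f i ≡ 0) → ∑ n f ≡ 0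
∑-zero n e = trans (∑-cong n e) (trans (∑-const n 0) (*-zeroʳ n))

∑-suc : ∀ n f → ∑ (suc n) f ≡ f 0 + ∑ n (λ i → f (suc i))
∑-suc zero    f = +-comm 0 (f 0)
∑-suc (suc n) f rewrite ∑-suc n f = +-assoc (f 0) _ _

∑-double : ∀ n f → ∑ (double n) f ≡ ∑ n (λ j → f (double j) + f (suc (double j)))
∑-double zero    f = refl
∑-double (suc n) f rewrite ∑-double n f = +-assoc _ (f (double n)) (f (suc (double n)))

∑-odd : ∀ m → ∑ m (λ j → suc (double j)) ≡ m * m
∑-odd zero    = refl
∑-odd (suc m) rewrite ∑-odd m | double≡2* m = lemma m
  where
  lemma : ∀ m → m * m + suc (2 * m) ≡ suc m * suc m
  lemma = solve-∀

∑-≢0⇒∃ : ∀ n f → ∑ n f ≢ 0 → Σ ℕ λ i → i < n × f i ≢ 0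
∑-≢0⇒∃ zero    f ∑≢0 = ⊥-elim (∑≢0 refl)
∑-≢0⇒∃ (suc n) f ∑≢0 with f n ≟ 0
... | no fn≢0 = n , ≤-refl , fn≢0
... | yes fn≡0 with ∑-≢0⇒∃ n f (λ ∑≡0 → ∑≢0 (cong₂ _+_ ∑≡0 fn≡0))
...   | i , i<n , fi≢0 = i , m<n⇒m<1+n i<n , fi≢0

∑-≤1 : ∀ n f → (∀ i → i < n → f i ≤ 1) →
       (∀ i j → i < n → j < n → f i ≢ 0 → f j ≢ 0 → i ≡ j) → ∑ n f ≤ 1
∑-≤1 zero    f ≤1 unique = z≤n
∑-≤1 (suc n) f ≤1 unique with f n ≟ 0
... | yes fn≡0 = subst (_≤ 1) (sym (trans (cong (λ z → ∑ n f + z) fn≡0) (+-identityʳ _)))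
                   (∑-≤1 n f (λ i i<n → ≤1 i (m<n⇒m<1+n i<n))
                     (λ i j i<n j<n → unique i j (m<n⇒m<1+n i<n) (m<n⇒m<1+n j<n)))
... | no fn≢0 = subst (_≤ 1) (sym (cong (_+ f n) rest≡0)) (≤1 n ≤-refl)
  where
  others≡0 : ∀ i → i < n → f i ≡ 0
  others≡0 i i<n with f i ≟ 0
  ... | yes fi≡0 = fi≡0
  ... | no fi≢0 = ⊥-elim (<⇒≢ i<n (unique i n (m<n⇒m<1+n i<n) ≤-refl fi≢0 fn≢0))
  rest≡0 : ∑ n f ≡ 0
  rest≡0 = ∑-zero n others≡0

𝟙< : ℕ → ℕ → ℕ
𝟙< a b with a <? b
... | yes _ = 1
... | no _  = 0

𝟙<-yes : ∀ {a b} → a < b → 𝟙< a b ≡ 1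
𝟙<-yes {a} {b} a<b with a <? b
... | yes _  = refl
... | no a≮b = ⊥-elim (a≮b a<b)

𝟙<-no : ∀ {a b} → ¬ a < b → 𝟙< a b ≡ 0
𝟙<-no {a} {b} a≮b with a <? b
... | yes a<b = ⊥-elim (a≮b a<b)
... | no _    = refl

𝟙<-cong : ∀ {a b c d} → (a < b ⇔ c < d) → 𝟙< a b ≡ 𝟙< c d
𝟙<-cong {a} {b} a<b⇔c<d with a <? b
... | yes a<b = sym (𝟙<-yes (Equivalence.to a<b⇔c<d a<b))
... | no a≮b  = sym (𝟙<-no (a≮b ∘ Equivalence.from a<b⇔c<d))

+-<⇔<-∸ : ∀ i j m → i + j < m ⇔ i < m ∸ j
+-<⇔<-∸ i j m = mk⇔ (m+n≤o⇒m≤o∸n (suc i))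
  (λ i<m∸j → m≤o∸n⇒m+n≤o (suc i) (<⇒≤ (m∸n≢0⇒n<m (λ m∸j≡0 → n≮0 (subst (i <_) m∸j≡0 i<m∸j))))
                         i<m∸j)

∑-𝟙< : ∀ k d → ∑ k (λ i → 𝟙< i d) ≡ k ⊓ d
∑-𝟙< zero    d = refl
∑-𝟙< (suc k) d rewrite ∑-𝟙< k d with k <? d
... | yes k<d rewrite m≤n⇒m⊓n≡m (<⇒≤ k<d) | m≤n⇒m⊓n≡m k<d = +-comm k 1
... | no k≮d rewrite m≥n⇒m⊓n≡n (≮⇒≥ k≮d) | m≥n⇒m⊓n≡n (≤-trans (≮⇒≥ k≮d) (n≤1+n k)) =
  +-identityʳ d

∑-𝟙<-+ : ∀ k j m → ∑ k (λ i → 𝟙< (i + j) m) ≡ k ⊓ (m ∸ j)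
∑-𝟙<-+ k j m = trans (∑-cong k λ i _ → 𝟙<-cong (+-<⇔<-∸ i j m)) (∑-𝟙< k (m ∸ j))

-- The generators acting on signed integers

swapPair-first : ∀ a b → swapPair a b a ≡ b
swapPair-first a b with a ℤ.≟ a
... | yes _  = refl
... | no a≢a = ⊥-elim (a≢a refl)

swapPair-second : ∀ a b → a ≢ b → swapPair a b b ≡ a
swapPair-second a b a≢b with b ℤ.≟ a
... | yes b≡a = ⊥-elim (a≢b (sym b≡a))
... | no _ with b ℤ.≟ b
...   | yes _  = refl
...   | no b≢b = ⊥-elim (b≢b refl)

swapPair-other : ∀ a b x → x ≢ a → x ≢ b → swapPair a b x ≡ x
swapPair-other a b x x≢a x≢b with x ℤ.≟ a
... | yes x≡a = ⊥-elim (x≢a x≡a)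
... | no _ with x ℤ.≟ b
...   | yes x≡b = ⊥-elim (x≢b x≡b)
...   | no _    = refl

gen : ℕ → ℤ → ℤ
gen j = genAct (suc j)

-- On magnitudes, gen j transposes low j and suc (low j); gen 0 and gen 1 both act on {1, 2}.
low : ℕ → ℕ
low zero    = 1
low (suc j) = suc j

Moves : ℕ → ℕ → Set
Moves j m = m ≡ low j ⊎ m ≡ suc (low j)

moves? : ∀ j m → Dec (Moves j m)
moves? j m with m ≟ low j
... | yes m≡l = yes (inj₁ m≡l)
... | no m≢l with m ≟ suc (low j)
...   | yes m≡l′ = yes (inj₂ m≡l′)
...   | no m≢l′  = no λ { (inj₁ m≡l) → m≢l m≡l ; (inj₂ m≡l′) → m≢l′ m≡l′ }

¬Moves-> : ∀ j {m} → suc (low j) < m → ¬ Moves j m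
¬Moves-> j l+1<m (inj₁ refl) = <-asym (n<1+n _) l+1<m
¬Moves-> j l+1<m (inj₂ refl) = <-irrefl refl l+1<m

¬Moves-< : ∀ j {m} → m < low j → ¬ Moves j m
¬Moves-< j m<l (inj₁ refl) = <-irrefl refl m<l
¬Moves-< j m<l (inj₂ refl) = <-asym (n<1+n _) m<l

magSwap : ℕ → ℕ → ℕ
magSwap j m with m ≟ low j
... | yes _ = suc (low j)
... | no _ with m ≟ suc (low j)
...   | yes _ = low j
...   | no _  = m

magSwap-low : ∀ j → magSwap j (low j) ≡ suc (low j)
magSwap-low j with low j ≟ low j
... | yes _  = refl
... | no l≢l = ⊥-elim (l≢l refl)

magSwap-suclow : ∀ j → magSwap j (suc (low j)) ≡ low j
magSwap-suclow j with suc (low j) ≟ low j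
... | yes 1+l≡l = ⊥-elim (1+n≢n 1+l≡l)
... | no _ with suc (low j) ≟ suc (low j)
...   | yes _  = refl
...   | no l≢l = ⊥-elim (l≢l refl)

magSwap-fix : ∀ j m → ¬ Moves j m → magSwap j m ≡ m
magSwap-fix j m ¬moves with m ≟ low j
... | yes m≡l = ⊥-elim (¬moves (inj₁ m≡l))
... | no _ with m ≟ suc (low j)
...   | yes m≡l′ = ⊥-elim (¬moves (inj₂ m≡l′))
...   | no _     = refl

magSwap-involutive : ∀ j m → magSwap j (magSwap j m) ≡ m
magSwap-involutive j m with moves? j m
... | yes (inj₁ refl) = trans (cong (magSwap j) (magSwap-low j)) (magSwap-suclow j)
... | yes (inj₂ refl) = trans (cong (magSwap j) (magSwap-suclow j)) (magSwap-low j)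
... | no ¬moves       = trans (cong (magSwap j) (magSwap-fix j m ¬moves)) (magSwap-fix j m ¬moves)

magSwap-injective : ∀ j {a b} → magSwap j a ≡ magSwap j b → a ≡ b
magSwap-injective j {a} {b} e =
  trans (sym (magSwap-involutive j a)) (trans (cong (magSwap j) e) (magSwap-involutive j b))

magSwap-zero : ∀ j → magSwap j 0 ≡ 0
magSwap-zero zero    = refl
magSwap-zero (suc j) = refl

adjacent-cmp : ∀ p m → m ≢ p → m ≢ suc p → (p < m ⇔ suc p < m) × (m < p ⇔ m < suc p)
adjacent-cmp p m m≢p m≢p+1 =
  mk⇔ (λ p<m → ≤∧≢⇒< p<m (m≢p+1 ∘ sym)) (<-trans (n<1+n p)) ,
  mk⇔ m<n⇒m<1+n (λ m<p+1 → ≤∧≢⇒< (s≤s⁻¹ m<p+1) m≢p)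

magSwap-cmp : ∀ j {m n} → ¬ Moves j m → Moves j n →
              (n < m ⇔ magSwap j n < m) × (m < n ⇔ m < magSwap j n)
magSwap-cmp j {m} ¬moves (inj₁ refl) rewrite magSwap-low j =
  adjacent-cmp (low j) m (¬moves ∘ inj₁) (¬moves ∘ inj₂)
magSwap-cmp j {m} ¬moves (inj₂ refl) rewrite magSwap-suclow j =
  let >⇔ , <⇔ = adjacent-cmp (low j) m (¬moves ∘ inj₁) (¬moves ∘ inj₂)
  in  ⇔.sym >⇔ , ⇔.sym <⇔

magSwap-reverses : ∀ j {a b} → Moves j a → Moves j b → a < b → magSwap j b < magSwap j a
magSwap-reverses j (inj₁ refl) (inj₁ refl) a<b = ⊥-elim (<-irrefl refl a<b)
magSwap-reverses j (inj₁ refl) (inj₂ refl) _ rewrite magSwap-low j | magSwap-suclow j = n<1+n _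
magSwap-reverses j (inj₂ refl) (inj₁ refl) a<b = ⊥-elim (<-asym a<b (n<1+n _))
magSwap-reverses j (inj₂ refl) (inj₂ refl) a<b = ⊥-elim (<-irrefl refl a<b)

moves-two-valued : ∀ j {x y z} → Moves j x → Moves j y → Moves j z → x ≢ z → y ≡ x ⊎ y ≡ z
moves-two-valued j (inj₁ refl) (inj₁ refl) _           _   = inj₁ refl
moves-two-valued j (inj₂ refl) (inj₂ refl) _           _   = inj₁ refl
moves-two-valued j (inj₁ refl) (inj₂ refl) (inj₂ refl) _   = inj₂ refl
moves-two-valued j (inj₁ refl) (inj₂ refl) (inj₁ refl) x≢z = ⊥-elim (x≢z refl)
moves-two-valued j (inj₂ refl) (inj₁ refl) (inj₁ refl) _   = inj₂ refl
moves-two-valued j (inj₂ refl) (inj₁ refl) (inj₂ refl) x≢z = ⊥-elim (x≢z refl)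

moves₀-below : ∀ {m n} → ¬ Moves 0 m → m ≢ 0 → Moves 0 n → n < m
moves₀-below {0}                 _      m≢0 _ = ⊥-elim (m≢0 refl)
moves₀-below {1}                 ¬moves _   _ = ⊥-elim (¬moves (inj₁ refl))
moves₀-below {2}                 ¬moves _   _ = ⊥-elim (¬moves (inj₂ refl))
moves₀-below {suc (suc (suc _))} _ _ (inj₁ refl) = s≤s (s≤s z≤n)
moves₀-below {suc (suc (suc _))} _ _ (inj₂ refl) = s≤s (s≤s (s≤s z≤n))

∣∣-≢ : ∀ {x y} → ∣ x ∣ ≢ ∣ y ∣ → x ≢ y
∣∣-≢ ∣x∣≢∣y∣ x≡y = ∣x∣≢∣y∣ (cong ∣_∣ x≡y)

gen-fix : ∀ j x → ¬ Moves j ∣ x ∣ → gen j x ≡ x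
gen-fix zero x ¬moves =
  trans (cong (swapPair (+ 1) (- (+ 2)))
              (swapPair-other _ _ x (∣∣-≢ (¬moves ∘ inj₁)) (∣∣-≢ (¬moves ∘ inj₂))))
        (swapPair-other _ _ x (∣∣-≢ (¬moves ∘ inj₁)) (∣∣-≢ (¬moves ∘ inj₂)))
gen-fix (suc k) x ¬moves =
  trans (cong (swapPair (+ suc k) (+ suc (suc k)))
              (swapPair-other _ _ x (∣∣-≢ (¬moves ∘ inj₁)) (∣∣-≢ (¬moves ∘ inj₂))))
        (swapPair-other _ _ x (∣∣-≢ (¬moves ∘ inj₁)) (∣∣-≢ (¬moves ∘ inj₂)))

∣gen∣-fix : ∀ j x → ¬ Moves j ∣ x ∣ → ∣ gen j x ∣ ≡ magSwap j ∣ x ∣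
∣gen∣-fix j x ¬moves = trans (cong ∣_∣ (gen-fix j x ¬moves)) (sym (magSwap-fix j ∣ x ∣ ¬moves))

withSignOf : ℤ → ℕ → ℤ
withSignOf (+ _)    m = + m
withSignOf -[1+ _ ] m = - (+ m)

gen-suc : ∀ k x → gen (suc k) x ≡ withSignOf x (magSwap (suc k) ∣ x ∣)
gen-suc k (+ M) with moves? (suc k) M
... | yes (inj₁ refl) =
  trans (cong (swapPair (+ suc k) (+ suc (suc k)))
              (swapPair-other -[1+ k ] -[1+ suc k ] (+ suc k) (λ ()) (λ ())))
        (trans (swapPair-first (+ suc k) (+ suc (suc k)))
               (cong +_ (sym (magSwap-low (suc k)))))
... | yes (inj₂ refl) =
  trans (cong (swapPair (+ suc k) (+ suc (suc k)))
              (swapPair-other -[1+ k ] -[1+ suc k ] (+ suc (suc k)) (λ ()) (λ ())))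
        (trans (swapPair-second (+ suc k) (+ suc (suc k)) (∣∣-≢ (1+n≢n ∘ sym)))
               (cong +_ (sym (magSwap-suclow (suc k)))))
... | no ¬moves = trans (gen-fix (suc k) (+ M) ¬moves) (cong +_ (sym (magSwap-fix (suc k) M ¬moves)))
gen-suc k -[1+ t ] with moves? (suc k) (suc t)
... | yes (inj₁ refl) =
  trans (cong (swapPair (+ suc k) (+ suc (suc k)))
              (swapPair-first -[1+ k ] -[1+ suc k ]))
        (trans (swapPair-other (+ suc k) (+ suc (suc k)) -[1+ suc k ] (λ ()) (λ ()))
               (cong (-_ ∘ +_) (sym (magSwap-low (suc k)))))
... | yes (inj₂ refl) =
  trans (cong (swapPair (+ suc k) (+ suc (suc k)))
              (swapPair-second -[1+ k ] -[1+ suc k ] (∣∣-≢ (1+n≢n ∘ sym))))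
        (trans (swapPair-other (+ suc k) (+ suc (suc k)) -[1+ k ] (λ ()) (λ ()))
               (cong (-_ ∘ +_) (sym (magSwap-suclow (suc k)))))
... | no ¬moves =
  trans (gen-fix (suc k) -[1+ t ] ¬moves) (cong (-_ ∘ +_) (sym (magSwap-fix (suc k) (suc t) ¬moves)))

gen-suc-- : ∀ k M → gen (suc k) (- (+ M)) ≡ - (+ magSwap (suc k) M)
gen-suc-- k zero    = gen-suc k (+ 0)
gen-suc-- k (suc t) = gen-suc k -[1+ t ]

∣gen∣ : ∀ j x → ∣ gen j x ∣ ≡ magSwap j ∣ x ∣
∣gen∣ (suc k) x = trans (cong ∣_∣ (gen-suc k x)) (∣withSignOf∣ x)
  where
  ∣withSignOf∣ : ∀ x {m} → ∣ withSignOf x m ∣ ≡ m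
  ∣withSignOf∣ (+ _)    = refl
  ∣withSignOf∣ -[1+ _ ] = ℤ.∣-i∣≡∣i∣ (+ _)
∣gen∣ zero (+ 0)    = refl
∣gen∣ zero (+ 1)    = refl
∣gen∣ zero (+ 2)    = refl
∣gen∣ zero -[1+ 0 ] = refl
∣gen∣ zero -[1+ 1 ] = refl
∣gen∣ zero x@(+ suc (suc (suc _)))  = ∣gen∣-fix 0 x (¬Moves-> 0 (s≤s (s≤s (s≤s z≤n))))
∣gen∣ zero x@(-[1+ suc (suc _) ]) = ∣gen∣-fix 0 x (¬Moves-> 0 (s≤s (s≤s (s≤s z≤n))))

negWeight : ℤ → ℕ
negWeight (+ _)    = 0
negWeight -[1+ _ ] = 2

negWeight-≤ : ∀ y → negWeight y ≤ 2
negWeight-≤ (+ _)    = z≤n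
negWeight-≤ -[1+ _ ] = ≤-refl

negWeight-gen-suc : ∀ k y → negWeight (gen (suc k) y) ≡ negWeight y
negWeight-gen-suc k (+ M)    = cong negWeight (gen-suc k (+ M))
negWeight-gen-suc k -[1+ t ] =
  trans (cong negWeight (gen-suc k -[1+ t ])) (lemma (magSwap (suc k) (suc t)) refl)
  where
  lemma : ∀ m → magSwap (suc k) (suc t) ≡ m → negWeight (- (+ m)) ≡ 2
  lemma zero    eq = ⊥-elim (0≢1+n {t} (magSwap-injective (suc k) (trans (magSwap-zero (suc k)) (sym eq))))
  lemma (suc _) _  = refl

act : List ℕ → ℤ → ℤ
act []      x = x
act (j ∷ l) x = gen j (act l x)

act-++ : ∀ l l′ x → act (l ++ l′) x ≡ act l (act l′ x)
act-++ []      l′ x = refl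
act-++ (j ∷ l) l′ x = cong (gen j) (act-++ l l′ x)

magAct : List ℕ → ℕ → ℕ
magAct []      m = m
magAct (j ∷ l) m = magSwap j (magAct l m)

magAct-++ : ∀ l l′ m → magAct (l ++ l′) m ≡ magAct l (magAct l′ m)
magAct-++ []      l′ m = refl
magAct-++ (j ∷ l) l′ m = cong (magSwap j) (magAct-++ l l′ m)

∣act∣ : ∀ l x → ∣ act l x ∣ ≡ magAct l ∣ x ∣
∣act∣ []      x = refl
∣act∣ (j ∷ l) x = trans (∣gen∣ j (act l x)) (cong (magSwap j) (∣act∣ l x))

act-+ : ∀ l → All (1 ≤_) l → ∀ M → act l (+ M) ≡ + magAct l M
act-+ []          []            M = refl
act-+ (suc k ∷ l) (s≤s z≤n ∷ ps) M =
  trans (cong (gen (suc k)) (act-+ l ps M)) (gen-suc k (+ magAct l M))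

act-- : ∀ l → All (1 ≤_) l → ∀ M → act l (- (+ M)) ≡ - (+ magAct l M)
act-- []          []            M = refl
act-- (suc k ∷ l) (s≤s z≤n ∷ ps) M =
  trans (cong (gen (suc k)) (act-- l ps M)) (gen-suc-- k (magAct l M))

ActsBelow : ℕ → List ℕ → Set
ActsBelow B = All λ j → suc (low j) ≤ B

act-fix : ∀ {B} l x → ActsBelow B l → B < ∣ x ∣ → act l x ≡ x
act-fix []      x []            _     = refl
act-fix (j ∷ l) x (bound ∷ bounds) B<∣x∣ =
  trans (cong (gen j) (act-fix l x bounds B<∣x∣)) (gen-fix j x ¬moves)
  where
  ¬moves : ¬ Moves j ∣ x ∣
  ¬moves (inj₁ ∣x∣≡l)  = <-asym B<∣x∣ (≤-trans (s≤s (≤-reflexive ∣x∣≡l)) bound)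
  ¬moves (inj₂ ∣x∣≡l′) = <⇒≱ B<∣x∣ (≤-trans (≤-reflexive ∣x∣≡l′) bound)

magAct-injective : ∀ l {a b} → magAct l a ≡ magAct l b → a ≡ b
magAct-injective []      eq = eq
magAct-injective (j ∷ l) eq = magAct-injective l (magSwap-injective j eq)

magAct-zero : ∀ l → magAct l 0 ≡ 0
magAct-zero []      = refl
magAct-zero (j ∷ l) = trans (cong (magSwap j) (magAct-zero l)) (magSwap-zero j)

evalWord≡act : ∀ {n} (ws : Word n) x → evalWord ws x ≡ act (map toℕ ws) x
evalWord≡act []       x = refl
evalWord≡act (j ∷ ws) x = cong (gen (toℕ j)) (evalWord≡act ws x)

toWord : ∀ n l → All (_< n) l → Word n
toWord n []      []            = []
toWord n (j ∷ l) (j<n ∷ l<n)   = fromℕ< j<n ∷ toWord n l l<n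

evalWord-toWord : ∀ n l (l<n : All (_< n) l) x → evalWord (toWord n l l<n) x ≡ act l x
evalWord-toWord n []      []          x = refl
evalWord-toWord n (j ∷ l) (j<n ∷ l<n) x rewrite evalWord-toWord n l l<n x | toℕ-fromℕ< j<n = refl

length-toWord : ∀ n l (l<n : All (_< n) l) → length (toWord n l l<n) ≡ length l
length-toWord n []      []          = refl
length-toWord n (j ∷ l) (j<n ∷ l<n) = cong suc (length-toWord n l l<n)

letters-< : ∀ {B} l → ActsBelow B l → All (_< B) l
letters-< l = All.map λ {j} bound → <-≤-trans (j<suc-low j) bound
  where
  j<suc-low : ∀ j → j < suc (low j)
  j<suc-low zero    = s≤s z≤n
  j<suc-low (suc j) = ≤-refl

magAct-fix : ∀ {B} l M → ActsBelow B l → B < M → magAct l M ≡ M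
magAct-fix l M bounds B<M = trans (sym (∣act∣ l (+ M))) (cong ∣_∣ (act-fix l (+ M) bounds B<M))

-- The length statistic is a lower bound for the length

byMagnitude : ℕ → ℕ → ℕ → ℕ
byMagnitude a b s with b <? a
... | yes _ = 1
... | no _ with a <? b
...   | yes _ = s
...   | no _  = 0

byMagnitude-> : ∀ a b s → b < a → byMagnitude a b s ≡ 1
byMagnitude-> a b s b<a with b <? a
... | yes _  = refl
... | no b≮a = ⊥-elim (b≮a b<a)

byMagnitude-< : ∀ a b s → a < b → byMagnitude a b s ≡ s
byMagnitude-< a b s a<b with b <? a
... | yes b<a = ⊥-elim (<-asym a<b b<a)
... | no _ with a <? b
...   | yes _  = refl
...   | no a≮b = ⊥-elim (a≮b a<b)

byMagnitude-≤ : ∀ a b s → s ≤ 2 → byMagnitude a b s ≤ 2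
byMagnitude-≤ a b s s≤2 with b <? a
... | yes _ = s≤s z≤n
... | no _ with a <? b
...   | yes _ = s≤2
...   | no _  = z≤n

byMagnitude-cong : ∀ {a b s a′ b′ s′} → (b < a ⇔ b′ < a′) → (a < b ⇔ a′ < b′) →
                   (a < b → s ≡ s′) → byMagnitude a b s ≡ byMagnitude a′ b′ s′
byMagnitude-cong {a} {b} {a′ = a′} {b′ = b′} >⇔ <⇔ s≡ with b <? a | b′ <? a′
... | yes _   | yes _    = refl
... | yes b<a | no b′≮a′ = ⊥-elim (b′≮a′ (Equivalence.to >⇔ b<a))
... | no b≮a  | yes b′<a′ = ⊥-elim (b≮a (Equivalence.from >⇔ b′<a′))
... | no _    | no _ with a <? b | a′ <? b′
...   | yes a<b | yes _    = s≡ a<b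
...   | yes a<b | no a′≮b′ = ⊥-elim (a′≮b′ (Equivalence.to <⇔ a<b))
...   | no a≮b  | yes a′<b′ = ⊥-elim (a≮b (Equivalence.from <⇔ a′<b′))
...   | no _    | no _     = refl

-- The contribution to L(w) of positions i < j with x = w(i), y = w(j); lengthStat n w is L(w).
pairLength : ℤ → ℤ → ℕ
pairLength x y = byMagnitude ∣ x ∣ ∣ y ∣ (negWeight y)

lengthStat : ℕ → (ℕ → ℤ) → ℕ
lengthStat n w = ∑ n λ b → ∑ b λ a → pairLength (w (suc a)) (w (suc b))

pairLength-gen : ∀ j x y → ∣ x ∣ ≢ 0 → ¬ (Moves j ∣ x ∣ × Moves j ∣ y ∣) →
                 pairLength (gen j x) (gen j y) ≡ pairLength x y
pairLength-gen j x y ∣x∣≢0 ¬both with moves? j ∣ x ∣ | moves? j ∣ y ∣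
... | yes mx | yes my = ⊥-elim (¬both (mx , my))
... | no ¬mx | no ¬my rewrite gen-fix j x ¬mx | gen-fix j y ¬my = refl
... | yes mx | no ¬my rewrite gen-fix j y ¬my | ∣gen∣ j x =
  let >⇔ , <⇔ = magSwap-cmp j ¬my mx in byMagnitude-cong (⇔.sym <⇔) (⇔.sym >⇔) (λ _ → refl)
... | no ¬mx | yes my rewrite gen-fix j x ¬mx | ∣gen∣ j y =
  let >⇔ , <⇔ = magSwap-cmp j ¬mx my in
  byMagnitude-cong (⇔.sym >⇔) (⇔.sym <⇔) (sameSign j ¬mx my ∘ Equivalence.from <⇔)
  where
  sameSign : ∀ j → ¬ Moves j ∣ x ∣ → Moves j ∣ y ∣ → ∣ x ∣ < ∣ y ∣ →
             negWeight (gen j y) ≡ negWeight y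
  sameSign zero    ¬mx my ∣x∣<∣y∣ = ⊥-elim (<-asym ∣x∣<∣y∣ (moves₀-below ¬mx ∣x∣≢0 my))
  sameSign (suc k) _   _  _       = negWeight-gen-suc k y

module _ (j : ℕ) (w : ℕ → ℤ)
         (∣w∣≢0 : ∀ p → ∣ w (suc p) ∣ ≢ 0)
         (∣w∣-injective : ∀ p q → ∣ w (suc p) ∣ ≡ ∣ w (suc q) ∣ → p ≡ q) where

  private
    mag : ℕ → ℕ
    mag p = ∣ w (suc p) ∣

    before after increase : ℕ → ℕ → ℕ
    before a b = pairLength (w (suc a)) (w (suc b))
    after a b = pairLength (gen j (w (suc a))) (gen j (w (suc b)))
    increase a b = after a b ∸ before a b

    mag-≢ : ∀ {a b} → a ≢ b → mag a ≢ mag b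
    mag-≢ a≢b eq = a≢b (∣w∣-injective _ _ eq)

    unchanged : ∀ a b → ¬ (Moves j (mag a) × Moves j (mag b)) → increase a b ≡ 0
    unchanged a b ¬both =
      trans (cong (_∸ before a b) (pairLength-gen j _ _ (∣w∣≢0 a) ¬both)) (n∸n≡0 (before a b))

    increase≢0⇒moves : ∀ a b → increase a b ≢ 0 → Moves j (mag a) × Moves j (mag b)
    increase≢0⇒moves a b inc≢0 with moves? j (mag a) | moves? j (mag b)
    ... | yes ma | yes mb = ma , mb
    ... | no ¬ma | _      = ⊥-elim (inc≢0 (unchanged a b (¬ma ∘ proj₁)))
    ... | yes _  | no ¬mb = ⊥-elim (inc≢0 (unchanged a b (¬mb ∘ proj₂)))

    increase≤1 : ∀ a b → a ≢ b → increase a b ≤ 1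
    increase≤1 a b a≢b with increase a b ≟ 0
    ... | yes inc≡0 = subst (_≤ 1) (sym inc≡0) z≤n
    ... | no inc≢0 with increase≢0⇒moves a b inc≢0 | <-cmp (mag a) (mag b)
    ...   | _       , _  | tri≈ _ eq _ = ⊥-elim (mag-≢ a≢b eq)
    ...   | ma , mb | tri< a<b _ _ =
      subst (λ z → z ∸ before a b ≤ 1) (sym after≡1) (m∸n≤m 1 (before a b))
      where
      after≡1 : after a b ≡ 1
      after≡1 rewrite ∣gen∣ j (w (suc a)) | ∣gen∣ j (w (suc b)) =
        byMagnitude-> _ _ _ (magSwap-reverses j ma mb a<b)
    ...   | _       , _  | tri> _ _ b<a =
      subst (λ z → after a b ∸ z ≤ 1) (sym before≡1) (∸-monoˡ-≤ 1 after≤2)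
      where
      before≡1 : before a b ≡ 1
      before≡1 = byMagnitude-> (mag a) (mag b) _ b<a
      after≤2 : after a b ≤ 2
      after≤2 = byMagnitude-≤ ∣ gen j (w (suc a)) ∣ ∣ gen j (w (suc b)) ∣ _
                              (negWeight-≤ (gen j (w (suc b))))

    increase-unique : ∀ b a a′ → a < b → a′ < b →
                      increase a b ≢ 0 → increase a′ b ≢ 0 → a ≡ a′
    increase-unique b a a′ a<b a′<b inc≢0 inc′≢0
      with increase≢0⇒moves a b inc≢0 | increase≢0⇒moves a′ b inc′≢0
    ... | ma , mb | ma′ , _ with moves-two-valued j ma ma′ mb (mag-≢ (<⇒≢ a<b))
    ...   | inj₁ eq = sym (∣w∣-injective _ _ eq)
    ...   | inj₂ eq = ⊥-elim (<⇒≢ a′<b (∣w∣-injective _ _ eq))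

    columnIncrease : ℕ → ℕ
    columnIncrease b = ∑ b λ a → increase a b

    columnIncrease-≤1 : ∀ b → columnIncrease b ≤ 1
    columnIncrease-≤1 b = ∑-≤1 b (λ a → increase a b) (λ a a<b → increase≤1 a b (<⇒≢ a<b))
                            (λ a a′ a<b a′<b → increase-unique b a a′ a<b a′<b)

    -- Positions a < b and a′ < b′ with nonzero increase all hold one of the two magnitudes moved
    -- by gen j, and distinct positions hold distinct magnitudes.
    columnIncrease-unique : ∀ b b′ → columnIncrease b ≢ 0 → columnIncrease b′ ≢ 0 → b ≡ b′
    columnIncrease-unique b b′ col≢0 col′≢0
      with ∑-≢0⇒∃ b (λ a → increase a b) col≢0 | ∑-≢0⇒∃ b′ (λ a → increase a b′) col′≢0
    ... | a , a<b , inc≢0 | a′ , a′<b′ , inc′≢0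
      with increase≢0⇒moves a b inc≢0 | increase≢0⇒moves a′ b′ inc′≢0
    ...   | ma , mb | ma′ , mb′ with moves-two-valued j ma mb′ mb (mag-≢ (<⇒≢ a<b))
    ...     | inj₂ eq = sym (∣w∣-injective _ _ eq)
    ...     | inj₁ eq with ∣w∣-injective _ _ eq
    ...       | refl with moves-two-valued j ma ma′ mb (mag-≢ (<⇒≢ a<b))
    ...         | inj₁ eq′ = ⊥-elim (<⇒≢ a′<b′ (∣w∣-injective _ _ eq′))
    ...         | inj₂ eq′ with ∣w∣-injective _ _ eq′
    ...           | refl = ⊥-elim (<-asym a<b a′<b′)

  lengthStat-gen-≤ : ∀ n → lengthStat n (gen j ∘ w) ≤ suc (lengthStat n w)
  lengthStat-gen-≤ n = begin
    lengthStat n (gen j ∘ w)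
      ≤⟨ ∑-mono-≤ n (λ b _ → ∑-mono-≤ b λ a _ → m≤n+m∸n (after a b) (before a b)) ⟩
    ∑ n (λ b → ∑ b λ a → before a b + increase a b)
      ≡⟨ ∑-cong n (λ b _ → ∑-distrib-+ b _ _) ⟩
    ∑ n (λ b → ∑ b (λ a → before a b) + columnIncrease b)
      ≡⟨ ∑-distrib-+ n _ _ ⟩
    lengthStat n w + ∑ n columnIncrease
      ≤⟨ +-monoʳ-≤ (lengthStat n w) (∑-≤1 n columnIncrease (λ b _ → columnIncrease-≤1 b)
                                                           (λ b b′ _ _ → columnIncrease-unique b b′)) ⟩
    lengthStat n w + 1
      ≡⟨ +-comm (lengthStat n w) 1 ⟩
    suc (lengthStat n w) ∎
    where open ≤-Reasoning

lengthStat-identity : ∀ n → lengthStat n (λ p → + p) ≡ 0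
lengthStat-identity n =
  ∑-zero n λ b _ → ∑-zero b λ a a<b → byMagnitude-< (suc a) (suc b) 0 (s≤s a<b)

lengthStat-act-≤ : ∀ n l → lengthStat n (λ p → act l (+ p)) ≤ length l
lengthStat-act-≤ n []      = ≤-reflexive (lengthStat-identity n)
lengthStat-act-≤ n (j ∷ l) =
  ≤-trans (lengthStat-gen-≤ j (λ p → act l (+ p)) ∣w∣≢0 ∣w∣-injective n)
          (s≤s (lengthStat-act-≤ n l))
  where
  ∣w∣≢0 : ∀ p → ∣ act l (+ suc p) ∣ ≢ 0
  ∣w∣≢0 p eq =
    0≢1+n (sym (magAct-injective l (trans (sym (∣act∣ l (+ suc p))) (trans eq (sym (magAct-zero l))))))
  ∣w∣-injective : ∀ p q → ∣ act l (+ suc p) ∣ ≡ ∣ act l (+ suc q) ∣ → p ≡ q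
  ∣w∣-injective p q eq =
    suc-injective (magAct-injective l (trans (sym (∣act∣ l (+ suc p))) (trans eq (∣act∣ l (+ suc q)))))

lengthStat-cong : ∀ n {v w} → (∀ p → 1 ≤ p → p ≤ n → v p ≡ w p) →
                  lengthStat n v ≡ lengthStat n w
lengthStat-cong n v≡w = ∑-cong n λ b b<n → ∑-cong b λ a a<b →
  cong₂ pairLength (v≡w (suc a) (s≤s z≤n) (<-trans a<b b<n)) (v≡w (suc b) (s≤s z≤n) b<n)

lengthStat-≤-length : ∀ n (ws : Word n) → lengthStat n (λ p → evalWord ws (+ p)) ≤ length ws
lengthStat-≤-length n ws =
  subst₂ _≤_ (lengthStat-cong n λ p _ _ → sym (evalWord≡act ws (+ p))) (length-map toℕ ws)
             (lengthStat-act-≤ n (map toℕ ws))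

CoxeterLength-intro : ∀ n w (ws : Word n) → Represents n ws w → length ws ≤ lengthStat n w →
                      CoxeterLength n w (length ws)
CoxeterLength-intro n w ws ws↦w length≤ = (ws , refl , ws↦w) , λ ws′ ws′↦w →
  ≤-trans length≤ (≤-trans (≤-reflexive (lengthStat-cong n λ p 1≤p p≤n → sym (ws′↦w p 1≤p p≤n)))
                           (lengthStat-≤-length n ws′))

-- A reduced word for w_{2m}

-- s_{q+2} s_{q+3} s_{q+2}, which transposes the magnitudes q+1 and q+3.
block : ℕ → List ℕ
block q = suc q ∷ suc (suc q) ∷ suc q ∷ []

-- t_1 t_2 ⋯ t_m, where t_i = block (2i - 1).
evenCycle : ℕ → List ℕ
evenCycle zero    = []
evenCycle (suc m) = evenCycle m ++ block (suc (double m))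

stage : ℕ → List ℕ
stage m = 0 ∷ 1 ∷ evenCycle m

wnWord : ℕ → List ℕ
wnWord zero    = []
wnWord (suc m) = stage m ++ wnWord m

block-low : ∀ q → magAct (block q) (suc q) ≡ suc (suc (suc q))
block-low q = begin
  magSwap e (magSwap (suc e) (magSwap e e)) ≡⟨ cong (magSwap e ∘ magSwap (suc e)) (magSwap-low e) ⟩
  magSwap e (magSwap (suc e) (suc e))       ≡⟨ cong (magSwap e) (magSwap-low (suc e)) ⟩
  magSwap e (suc (suc e))                   ≡⟨ magSwap-fix e _ (¬Moves-> e ≤-refl) ⟩
  suc (suc e)                               ∎
  where
  open ≡-Reasoning
  e : ℕ
  e = suc q

block-mid : ∀ q → magAct (block q) (suc (suc q)) ≡ suc (suc q)
block-mid q = begin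
  magSwap e (magSwap (suc e) (magSwap e (suc e)))
    ≡⟨ cong (magSwap e ∘ magSwap (suc e)) (magSwap-suclow e) ⟩
  magSwap e (magSwap (suc e) e)
    ≡⟨ cong (magSwap e) (magSwap-fix (suc e) e (¬Moves-< (suc e) ≤-refl)) ⟩
  magSwap e e
    ≡⟨ magSwap-low e ⟩
  suc e ∎
  where
  open ≡-Reasoning
  e : ℕ
  e = suc q

block-high : ∀ q → magAct (block q) (suc (suc (suc q))) ≡ suc q
block-high q = begin
  magSwap e (magSwap (suc e) (magSwap e (suc (suc e))))
    ≡⟨ cong (magSwap e ∘ magSwap (suc e)) (magSwap-fix e _ (¬Moves-> e ≤-refl)) ⟩
  magSwap e (magSwap (suc e) (suc (suc e)))
    ≡⟨ cong (magSwap e) (magSwap-suclow (suc e)) ⟩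
  magSwap e (suc e)
    ≡⟨ magSwap-suclow e ⟩
  e ∎
  where
  open ≡-Reasoning
  e : ℕ
  e = suc q

block-fix : ∀ q M → M ≢ suc q → M ≢ suc (suc (suc q)) → magAct (block q) M ≡ M
block-fix q M M≢e M≢e+2 with M ≟ suc (suc q)
... | yes refl = block-mid q
... | no M≢e+1 = trans (cong (magSwap e ∘ magSwap (suc e)) fix₁) (trans (cong (magSwap e) fix₂) fix₁)
  where
  e : ℕ
  e = suc q
  fix₁ : magSwap e M ≡ M
  fix₁ = magSwap-fix e M λ { (inj₁ M≡e) → M≢e M≡e
                           ; (inj₂ M≡e+1) → M≢e+1 M≡e+1 }
  fix₂ : magSwap (suc e) M ≡ M
  fix₂ = magSwap-fix (suc e) M λ { (inj₁ M≡e+1) → M≢e+1 M≡e+1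
                                 ; (inj₂ M≡e+2) → M≢e+2 M≡e+2 }

evenCycle-positive : ∀ m → All (1 ≤_) (evenCycle m)
evenCycle-positive zero    = []
evenCycle-positive (suc m) = ++⁺ (evenCycle-positive m) (s≤s z≤n ∷ s≤s z≤n ∷ s≤s z≤n ∷ [])

evenCycle-bound : ∀ m → ActsBelow (double (suc m)) (evenCycle m)
evenCycle-bound zero    = []
evenCycle-bound (suc m) =
  ++⁺ (All.map (λ bound → ≤-trans bound (≤-trans (n≤1+n _) (n≤1+n _))) (evenCycle-bound m))
      (n≤1+n _ ∷ ≤-refl ∷ n≤1+n _ ∷ [])

evenCycle-odd : ∀ m i → magAct (evenCycle m) (suc (double i)) ≡ suc (double i)
evenCycle-odd zero    i = refl
evenCycle-odd (suc m) i = trans (magAct-++ (evenCycle m) (block _) _)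
  (trans (cong (magAct (evenCycle m))
               (block-fix _ _ (suc-double≢double i (suc m)) (suc-double≢double i (suc (suc m)))))
         (evenCycle-odd m i))

evenCycle-even : ∀ m r → r < m → magAct (evenCycle m) (double (suc r)) ≡ double (suc (suc r))
evenCycle-even (suc m) r r<1+m with r ≟ m
... | yes refl = trans (magAct-++ (evenCycle r) (block _) _)
  (trans (cong (magAct (evenCycle r)) (block-low _))
         (magAct-fix (evenCycle r) _ (evenCycle-bound r) (double-mono-< ≤-refl)))
... | no r≢m = trans (magAct-++ (evenCycle m) (block _) _)
  (trans (cong (magAct (evenCycle m))
               (block-fix _ _ (<⇒≢ (double-mono-< (s≤s r<m)))
                              (<⇒≢ (double-mono-< (s≤s (m<n⇒m<1+n r<m))))))
         (evenCycle-even m r r<m))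
  where
  r<m : r < m
  r<m = ≤∧≢⇒< (s≤s⁻¹ r<1+m) r≢m

evenCycle-top : ∀ m → magAct (evenCycle m) (double (suc m)) ≡ 2
evenCycle-top zero    = refl
evenCycle-top (suc m) = trans (magAct-++ (evenCycle m) (block _) _)
  (trans (cong (magAct (evenCycle m)) (block-high _)) (evenCycle-top m))

s₁s₂-fix : ∀ x → 2 < ∣ x ∣ → act (0 ∷ 1 ∷ []) x ≡ x
s₁s₂-fix x = act-fix (0 ∷ 1 ∷ []) x (≤-refl ∷ ≤-refl ∷ [])

stage-+ : ∀ m M → act (stage m) (+ M) ≡ act (0 ∷ 1 ∷ []) (+ magAct (evenCycle m) M)
stage-+ m M = cong (act (0 ∷ 1 ∷ [])) (act-+ (evenCycle m) (evenCycle-positive m) M)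

stage-- : ∀ m M → act (stage m) (- (+ M)) ≡ act (0 ∷ 1 ∷ []) (- (+ magAct (evenCycle m) M))
stage-- m M = cong (act (0 ∷ 1 ∷ [])) (act-- (evenCycle m) (evenCycle-positive m) M)

stage-one : ∀ m → act (stage m) (+ 1) ≡ - (+ 1)
stage-one m = trans (stage-+ m 1) (cong (act (0 ∷ 1 ∷ []) ∘ +_) (evenCycle-odd m 0))

stage-minus-one : ∀ m → act (stage m) (- (+ 1)) ≡ + 1
stage-minus-one m = trans (stage-- m 1) (cong (act (0 ∷ 1 ∷ []) ∘ -_ ∘ +_) (evenCycle-odd m 0))

stage-odd : ∀ m i → act (stage m) (+ suc (double (suc i))) ≡ + suc (double (suc i))
stage-odd m i = trans (stage-+ m _)
  (trans (cong (act (0 ∷ 1 ∷ []) ∘ +_) (evenCycle-odd m (suc i)))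
         (s₁s₂-fix _ (s≤s (s≤s (s≤s z≤n)))))

stage-even : ∀ m r → r < m → act (stage m) (- (+ double (suc r))) ≡ - (+ double (suc (suc r)))
stage-even m r r<m = trans (stage-- m _)
  (trans (cong (act (0 ∷ 1 ∷ []) ∘ -_ ∘ +_) (evenCycle-even m r r<m))
         (s₁s₂-fix _ (s≤s (s≤s (s≤s z≤n)))))

stage-top : ∀ m → act (stage m) (+ double (suc m)) ≡ - (+ 2)
stage-top m = trans (stage-+ m _) (cong (act (0 ∷ 1 ∷ []) ∘ +_) (evenCycle-top m))

wnWord-bound : ∀ m → ActsBelow (double m) (wnWord m)
wnWord-bound zero    = []
wnWord-bound (suc m) =
  ++⁺ (s≤s (s≤s z≤n) ∷ s≤s (s≤s z≤n) ∷ evenCycle-bound m)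
      (All.map (λ bound → ≤-trans bound (≤-trans (n≤1+n _) (n≤1+n _))) (wnWord-bound m))

wnWord-large : ∀ m x → double m < ∣ x ∣ → act (wnWord m) x ≡ x
wnWord-large m x = act-fix (wnWord m) x (wnWord-bound m)

signPow-±1 : ∀ k → signPow k ≡ + 1 ⊎ signPow k ≡ - (+ 1)
signPow-±1 zero    = inj₁ refl
signPow-±1 (suc k) with signPow-±1 k
... | inj₁ eq = inj₂ (cong -_ eq)
... | inj₂ eq = inj₁ (cong -_ eq)

wnWord-one : ∀ m → act (wnWord m) (+ 1) ≡ signPow m
wnWord-one zero    = refl
wnWord-one (suc m) = trans (act-++ (stage m) (wnWord m) _)
  (trans (cong (act (stage m)) (wnWord-one m)) (negate (signPow-±1 m)))
  where
  negate : signPow m ≡ + 1 ⊎ signPow m ≡ - (+ 1) → act (stage m) (signPow m) ≡ - signPow m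
  negate (inj₁ eq) rewrite eq = stage-one m
  negate (inj₂ eq) rewrite eq = stage-minus-one m

wnWord-odd : ∀ m i → act (wnWord m) (+ suc (double (suc i))) ≡ + suc (double (suc i))
wnWord-odd zero    i = refl
wnWord-odd (suc m) i = trans (act-++ (stage m) (wnWord m) _)
  (trans (cong (act (stage m)) (wnWord-odd m i)) (stage-odd m i))

wnWord-even : ∀ m k → k < m → act (wnWord m) (+ double (suc k)) ≡ - (+ double (m ∸ k))
wnWord-even (suc m) k k<1+m with k ≟ m
... | yes refl = trans (act-++ (stage k) (wnWord k) _)
  (trans (cong (act (stage k)) (wnWord-large k _ (double-mono-< ≤-refl)))
         (trans (stage-top k) (cong (λ d → - (+ double d)) (sym (m+n∸n≡m 1 k)))))
... | no k≢m = begin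
  act (stage m ++ wnWord m) (+ double (suc k))      ≡⟨ act-++ (stage m) (wnWord m) _ ⟩
  act (stage m) (act (wnWord m) (+ double (suc k))) ≡⟨ cong (act (stage m)) (wnWord-even m k k<m) ⟩
  act (stage m) (- (+ double (m ∸ k)))              ≡⟨ cong (λ d → act (stage m) (- (+ double d))) m∸k≡1+r ⟩
  act (stage m) (- (+ double (suc r)))              ≡⟨ stage-even m r r<m ⟩
  - (+ double (suc (suc r)))                        ≡⟨ cong (λ d → - (+ double d)) 1+m∸k≡2+r ⟨
  - (+ double (suc m ∸ k))                          ∎
  where
  open ≡-Reasoning
  k<m : k < m
  k<m = ≤∧≢⇒< (s≤s⁻¹ k<1+m) k≢m
  r : ℕ
  r = m ∸ suc k
  m∸k≡1+r : m ∸ k ≡ suc r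
  m∸k≡1+r = +-∸-assoc 1 k<m
  1+m∸k≡2+r : suc m ∸ k ≡ suc (suc r)
  1+m∸k≡2+r = trans (+-∸-assoc 1 (<⇒≤ k<m)) (cong suc m∸k≡1+r)
  r<m : r < m
  r<m = subst (_≤ m) m∸k≡1+r (m∸n≤m m k)

length-evenCycle : ∀ m → length (evenCycle m) ≡ 3 * m
length-evenCycle zero    = refl
length-evenCycle (suc m) =
  trans (length-++ (evenCycle m)) (trans (cong (_+ 3) (length-evenCycle m)) (lemma m))
  where
  lemma : ∀ m → 3 * m + 3 ≡ 3 * suc m
  lemma = solve-∀

length-wnWord : ∀ m → 2 * length (wnWord m) ≡ 3 * m * m + m
length-wnWord zero    = refl
length-wnWord (suc m) = begin
  2 * length (stage m ++ wnWord m)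
    ≡⟨ cong (2 *_) (length-++ (stage m)) ⟩
  2 * (2 + length (evenCycle m) + length (wnWord m))
    ≡⟨ cong (λ k → 2 * (2 + k + length (wnWord m))) (length-evenCycle m) ⟩
  2 * (2 + 3 * m + length (wnWord m))
    ≡⟨ lemma m (length (wnWord m)) ⟩
  4 + 6 * m + 2 * length (wnWord m)
    ≡⟨ cong (λ z → 4 + 6 * m + z) (length-wnWord m) ⟩
  4 + 6 * m + (3 * m * m + m)
    ≡⟨ lemma′ m ⟩
  3 * suc m * suc m + suc m ∎
  where
  open ≡-Reasoning
  lemma : ∀ m L → 2 * (2 + 3 * m + L) ≡ 4 + 6 * m + 2 * L
  lemma = solve-∀
  lemma′ : ∀ m → 4 + 6 * m + (3 * m * m + m) ≡ 3 * suc m * suc m + suc m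
  lemma′ = solve-∀

-- The entries of w_n

data Position : ℕ → Set where
  one  : Position 1
  odd  : ∀ i → Position (suc (double (suc i)))
  even : ∀ k → Position (double (suc k))

position : ∀ i → Position (suc i)
position zero          = one
position (suc zero)    = even 0
position (suc (suc i)) = twoMore (position i)
  where
  twoMore : ∀ {i} → Position i → Position (suc (suc i))
  twoMore one      = odd 0
  twoMore (odd i)  = odd (suc i)
  twoMore (even k) = even (suc k)

wn-odd : ∀ n i → wn n (suc (double (suc i))) ≡ + suc (double (suc i))
wn-odd n i with n % 2 | suc (double (suc i)) % 2 | suc-double-%2 (suc i)
... | _ | .1 | refl = refl

wn-even-of-even : ∀ n k → n % 2 ≡ 0 → wn n (double (suc k)) ≡ - (+ (n + 2 ∸ double (suc k)))
wn-even-of-even n k n%2≡0 with n % 2 | double (suc k) % 2 | double-%2 (suc k)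
wn-even-of-even n k refl | .0 | .0 | refl = refl

wn-even-of-odd : ∀ n k → n % 2 ≡ 1 → wn n (double (suc k)) ≡ - (+ (n + 1 ∸ double (suc k)))
wn-even-of-odd n k n%2≡1 with n % 2 | double (suc k) % 2 | double-%2 (suc k)
wn-even-of-odd n k refl | .1 | .0 | refl = refl

wn-double-one : ∀ m → wn (double m) 1 ≡ signPow m
wn-double-one m = cong signPow (double-/2 m)

wn-double-even : ∀ m k → wn (double m) (double (suc k)) ≡ - (+ double (m ∸ k))
wn-double-even m k = trans (wn-even-of-even (double m) k (double-%2 m))
  (cong (λ d → - (+ d)) (trans (cong (_∸ double (suc k)) (+-comm (double m) 2)) (double-∸ m k)))

wn-suc-double : ∀ m i → wn (suc (double m)) (suc i) ≡ wn (double m) (suc i)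
wn-suc-double m i with position i
... | one    = cong signPow (trans (suc-double-/2 m) (sym (double-/2 m)))
... | odd i  = trans (wn-odd _ i) (sym (wn-odd _ i))
... | even k = trans (wn-even-of-odd _ k (suc-double-%2 m))
  (trans (cong (λ t → - (+ (t ∸ double (suc k)))) (sym (+-suc (double m) 1)))
         (sym (wn-even-of-even _ k (double-%2 m))))

wn-last : ∀ m → wn (suc (double m)) (suc (double m)) ≡ + suc (double m)
wn-last zero    = refl
wn-last (suc m) = wn-odd _ m

wnWord-represents : ∀ m i → suc i ≤ double m → act (wnWord m) (+ suc i) ≡ wn (double m) (suc i)
wnWord-represents m i 1+i≤2m with position i
... | one    = trans (wnWord-one m) (sym (wn-double-one m))
... | odd i′ = trans (wnWord-odd m i′) (sym (wn-odd _ i′))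
... | even k = trans (wnWord-even m k (double-cancel-≤ 1+i≤2m)) (sym (wn-double-even m k))

wnWord-represents-odd : ∀ m i → suc i ≤ suc (double m) →
                        act (wnWord m) (+ suc i) ≡ wn (suc (double m)) (suc i)
wnWord-represents-odd m i 1+i≤n with m≤n⇒m<n∨m≡n 1+i≤n
... | inj₁ 1+i<n = trans (wnWord-represents m i (s≤s⁻¹ 1+i<n)) (sym (wn-suc-double m i))
... | inj₂ refl  = trans (wnWord-large m _ ≤-refl) (sym (wn-last m))

-- The length statistic of w_{2m}

∣signPow∣ : ∀ k → ∣ signPow k ∣ ≡ 1
∣signPow∣ zero    = refl
∣signPow∣ (suc k) = trans (ℤ.∣-i∣≡∣i∣ (signPow k)) (∣signPow∣ k)

pairLength-≡ : ∀ x {y a y′} → ∣ x ∣ ≡ a → y ≡ y′ →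
               pairLength x y ≡ byMagnitude a ∣ y′ ∣ (negWeight y′)
pairLength-≡ x refl refl = refl

byMagnitude-odd-double : ∀ i d → byMagnitude (suc (double i)) (double d) 2 ≡ suc (𝟙< i d)
byMagnitude-odd-double i d with i <? d
... | yes i<d = byMagnitude-< _ _ 2 (double-mono-≤ i<d)
... | no i≮d  = byMagnitude-> _ _ 2 (s≤s (double-mono-≤ (≮⇒≥ i≮d)))

byMagnitude-double-odd : ∀ d j → byMagnitude (double d) (suc (double j)) 0 ≡ 𝟙< j d
byMagnitude-double-odd d j with j <? d
... | yes j<d = byMagnitude-> _ _ 0 (double-mono-≤ j<d)
... | no j≮d  = byMagnitude-< _ _ 0 (s≤s (double-mono-≤ (≮⇒≥ j≮d)))

minSum : ℕ → ℕ
minSum m = ∑ m λ j → j ⊓ (m ∸ j)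

minSum-suc-suc : ∀ m → minSum (suc (suc m)) ≡ minSum m + suc m
minSum-suc-suc m = begin
  minSum (suc (suc m))
    ≡⟨ ∑-suc (suc m) (λ j → j ⊓ (suc (suc m) ∸ j)) ⟩
  ∑ (suc m) (λ j → suc j ⊓ (suc m ∸ j))
    ≡⟨ ∑-cong (suc m) (λ j j≤m → cong (suc j ⊓_) (+-∸-assoc 1 (s≤s⁻¹ j≤m))) ⟩
  ∑ (suc m) (λ j → 1 + j ⊓ (m ∸ j))
    ≡⟨ ∑-distrib-+ (suc m) (λ _ → 1) (λ j → j ⊓ (m ∸ j)) ⟩
  ∑ (suc m) (λ _ → 1) + (minSum m + m ⊓ (m ∸ m))
    ≡⟨ cong₂ _+_ (trans (∑-const (suc m) 1) (*-identityʳ (suc m)))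
                 (cong (λ d → minSum m + m ⊓ d) (n∸n≡0 m)) ⟩
  suc m + (minSum m + m ⊓ 0)
    ≡⟨ cong (λ z → suc m + (minSum m + z)) (⊓-zeroʳ m) ⟩
  suc m + (minSum m + 0)
    ≡⟨ lemma (suc m) (minSum m) ⟩
  minSum m + suc m ∎
  where
  open ≡-Reasoning
  lemma : ∀ a b → a + (b + 0) ≡ b + a
  lemma = solve-∀

minSum-+-minSum-suc : ∀ m → 2 * (minSum m + minSum (suc m)) ≡ m * suc m
minSum-+-minSum-suc zero    = refl
minSum-+-minSum-suc (suc m) rewrite minSum-suc-suc m =
  trans (lemma (minSum m) (minSum (suc m)) m)
        (trans (cong (_+ 2 * suc m) (minSum-+-minSum-suc m)) (arith m))
  where
  lemma : ∀ a b m → 2 * (b + (a + suc m)) ≡ 2 * (a + b) + 2 * suc m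
  lemma = solve-∀
  arith : ∀ m → m * suc m + 2 * suc m ≡ suc m * suc (suc m)
  arith = solve-∀

module _ (m : ℕ) where
  private
    w : ℕ → ℤ
    w = wn (double m)

    ∣w-odd∣ : ∀ i → ∣ w (suc (double i)) ∣ ≡ suc (double i)
    ∣w-odd∣ zero    = trans (cong ∣_∣ (wn-double-one m)) (∣signPow∣ m)
    ∣w-odd∣ (suc i) = cong ∣_∣ (wn-odd _ i)

    ∣w-even∣ : ∀ i → ∣ w (double (suc i)) ∣ ≡ double (m ∸ i)
    ∣w-even∣ i = trans (cong ∣_∣ (wn-double-even m i)) (ℤ.∣-i∣≡∣i∣ (+ double (m ∸ i)))

    odd-odd : ∀ i j → i < j → pairLength (w (suc (double i))) (w (suc (double j))) ≡ 0
    odd-odd i (suc j) i<j =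
      trans (pairLength-≡ (w (suc (double i))) (∣w-odd∣ i) (wn-odd _ j))
            (byMagnitude-< _ _ 0 (s≤s (double-mono-< i<j)))

    even-odd : ∀ i j → i < j → pairLength (w (double (suc i))) (w (suc (double j))) ≡ 𝟙< (i + j) m
    even-odd i (suc j) i<j =
      trans (pairLength-≡ (w (double (suc i))) (∣w-even∣ i) (wn-odd _ j))
      (trans (byMagnitude-double-odd (m ∸ i) (suc j))
             (𝟙<-cong (⇔.sym (subst (λ k → k < m ⇔ suc j < m ∸ i) (+-comm (suc j) i)
                                    (+-<⇔<-∸ (suc j) i m)))))

    odd-even : ∀ i j → j < m →
               pairLength (w (suc (double i))) (w (double (suc j))) ≡ suc (𝟙< (i + j) m)
    odd-even i j j<m =
      trans (pairLength-≡ (w (suc (double i))) (∣w-odd∣ i)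
                          (trans (wn-double-even m j) (cong (λ d → - (+ double d)) m∸j≡1+r)))
      (trans (byMagnitude-odd-double i (suc r))
             (cong suc (trans (cong (𝟙< i) (sym m∸j≡1+r)) (𝟙<-cong (⇔.sym (+-<⇔<-∸ i j m))))))
      where
      r : ℕ
      r = m ∸ suc j
      m∸j≡1+r : m ∸ j ≡ suc r
      m∸j≡1+r = +-∸-assoc 1 j<m

    even-even : ∀ i j → i < j → j < m → pairLength (w (double (suc i))) (w (double (suc j))) ≡ 1
    even-even i j i<j j<m =
      trans (pairLength-≡ (w (double (suc i))) (∣w-even∣ i) (wn-double-even m j))
      (byMagnitude-> _ _ _ (subst (_< double (m ∸ i)) (sym (ℤ.∣-i∣≡∣i∣ (+ double (m ∸ j))))
                                  (double-mono-< (∸-monoʳ-< i<j (<⇒≤ j<m)))))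

    row : ℕ → ℕ
    row b = ∑ b λ a → pairLength (w (suc a)) (w (suc b))

    row-odd : ∀ j → row (double j) ≡ ∑ j λ i → 𝟙< (i + j) m
    row-odd j =
      trans (∑-double j _) (∑-cong j λ i i<j → cong₂ _+_ (odd-odd i j i<j) (even-odd i j i<j))

    row-even : ∀ j → j < m →
               row (suc (double j)) ≡ ∑ j (λ i → 𝟙< (i + j) m + 2) + suc (𝟙< (j + j) m)
    row-even j j<m = cong₂ _+_
      (trans (∑-double j _) (∑-cong j λ i i<j →
        trans (cong₂ _+_ (odd-even i j j<m) (even-even i j i<j j<m)) (sym (+-suc _ 1))))
      (odd-even j j j<m)

    rows : ∀ j → j < m →
           row (double j) + row (suc (double j)) ≡ suc (double j) + (j ⊓ (m ∸ j) + suc j ⊓ (m ∸ j))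
    rows j j<m = begin
      row (double j) + row (suc (double j))
        ≡⟨ cong₂ _+_ (row-odd j) (row-even j j<m) ⟩
      X + (∑ j (λ i → 𝟙< (i + j) m + 2) + suc y)
        ≡⟨ cong (λ z → X + (z + suc y)) ∑-plus-2 ⟩
      X + ((X + j * 2) + suc y)
        ≡⟨ arith X y j ⟩
      suc (2 * j) + (X + (X + y))
        ≡⟨ cong₂ (λ d z → suc d + z) (sym (double≡2* j)) (cong₂ _+_ (∑-𝟙<-+ j j m) (∑-𝟙<-+ (suc j) j m)) ⟩
      suc (double j) + (j ⊓ (m ∸ j) + suc j ⊓ (m ∸ j)) ∎
      where
      open ≡-Reasoning
      X y : ℕ
      X = ∑ j λ i → 𝟙< (i + j) m
      y = 𝟙< (j + j) m
      ∑-plus-2 : ∑ j (λ i → 𝟙< (i + j) m + 2) ≡ X + j * 2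
      ∑-plus-2 = trans (∑-distrib-+ j _ (λ _ → 2)) (cong (λ z → X + z) (∑-const j 2))
      arith : ∀ X y j → X + ((X + j * 2) + suc y) ≡ suc (2 * j) + (X + (X + y))
      arith = solve-∀

  lengthStat-wn-double : lengthStat (double m) (wn (double m)) ≡ m * m + (minSum m + minSum (suc m))
  lengthStat-wn-double = begin
    lengthStat (double m) w
      ≡⟨ ∑-double m row ⟩
    ∑ m (λ j → row (double j) + row (suc (double j)))
      ≡⟨ ∑-cong m rows ⟩
    ∑ m (λ j → suc (double j) + (j ⊓ (m ∸ j) + suc j ⊓ (m ∸ j)))
      ≡⟨ ∑-distrib-+ m _ _ ⟩
    ∑ m (λ j → suc (double j)) + ∑ m (λ j → j ⊓ (m ∸ j) + suc j ⊓ (m ∸ j))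
      ≡⟨ cong₂ _+_ (∑-odd m) (∑-distrib-+ m _ _) ⟩
    m * m + (minSum m + ∑ m (λ j → suc j ⊓ (m ∸ j)))
      ≡⟨ cong (λ z → m * m + (minSum m + z)) (sym (∑-suc m λ j → j ⊓ (suc m ∸ j))) ⟩
    m * m + (minSum m + minSum (suc m)) ∎
    where open ≡-Reasoning

length-wnWord≡lengthStat : ∀ m → length (wnWord m) ≡ lengthStat (double m) (wn (double m))
length-wnWord≡lengthStat m = *-cancelˡ-≡ _ _ 2 (begin
  2 * length (wnWord m)                         ≡⟨ length-wnWord m ⟩
  3 * m * m + m                                 ≡⟨ lemma m ⟨
  2 * (m * m) + m * suc m                       ≡⟨ cong (λ z → 2 * (m * m) + z) (minSum-+-minSum-suc m) ⟨
  2 * (m * m) + 2 * (minSum m + minSum (suc m)) ≡⟨ *-distribˡ-+ 2 (m * m) _ ⟨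
  2 * (m * m + (minSum m + minSum (suc m)))     ≡⟨ cong (2 *_) (lengthStat-wn-double m) ⟨
  2 * lengthStat (double m) (wn (double m))     ∎)
  where
  open ≡-Reasoning
  lemma : ∀ m → 2 * (m * m) + m * suc m ≡ 3 * m * m + m
  lemma = solve-∀

length-wnWord-formula : ∀ m → (3 * double m * double m + 2 * double m) / 8 ≡ length (wnWord m)
length-wnWord-formula m = trans (cong (_/ 8) numerator) (m*n/n≡m L 8)
  where
  open ≡-Reasoning
  L : ℕ
  L = length (wnWord m)
  numerator : 3 * double m * double m + 2 * double m ≡ L * 8
  numerator = begin
    3 * double m * double m + 2 * double m ≡⟨ cong (λ d → 3 * d * d + 2 * d) (double≡2* m) ⟩
    3 * (2 * m) * (2 * m) + 2 * (2 * m)    ≡⟨ lemma m ⟩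
    4 * (3 * m * m + m)                    ≡⟨ cong (4 *_) (length-wnWord m) ⟨
    4 * (2 * L)                            ≡⟨ lemma′ L ⟩
    L * 8                                  ∎
    where
    lemma : ∀ m → 3 * (2 * m) * (2 * m) + 2 * (2 * m) ≡ 4 * (3 * m * m + m)
    lemma = solve-∀
    lemma′ : ∀ L → 4 * (2 * L) ≡ L * 8
    lemma′ = solve-∀

wnWord-length : ∀ {n} m (l<n : All (_< n) (wnWord m)) →
                (∀ i → suc i ≤ n → act (wnWord m) (+ suc i) ≡ wn n (suc i)) →
                lengthStat (double m) (wn (double m)) ≤ lengthStat n (wn n) →
                CoxeterLength n (wn n) ((3 * double m * double m + 2 * double m) / 8)
wnWord-length {n} m l<n represents lengthStat≤ =
  subst (CoxeterLength n (wn n)) (trans (length-toWord _ _ l<n) (sym (length-wnWord-formula m)))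
    (CoxeterLength-intro n (wn n) (toWord n (wnWord m) l<n)
      (λ { zero () ; (suc i) _ 1+i≤n → trans (evalWord-toWord _ _ l<n _) (represents i 1+i≤n) })
      (≤-trans (≤-reflexive (trans (length-toWord _ _ l<n) (length-wnWord≡lengthStat m))) lengthStat≤))

wn-double-length : ∀ m →
  CoxeterLength (double m) (wn (double m)) ((3 * double m * double m + 2 * double m) / 8)
wn-double-length m =
  wnWord-length m (letters-< (wnWord m) (wnWord-bound m)) (wnWord-represents m) ≤-refl

wn-suc-double-length : ∀ m →
  CoxeterLength (suc (double m)) (wn (suc (double m))) ((3 * double m * double m + 2 * double m) / 8)
wn-suc-double-length m =
  wnWord-length m (All.map m<n⇒m<1+n (letters-< (wnWord m) (wnWord-bound m))) (wnWord-represents-odd m)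
    (≤-trans (≤-reflexive (lengthStat-cong (double m) {wn (double m)} {wn (suc (double m))}
                                           λ { zero () ; (suc i) _ _ → sym (wn-suc-double m i) }))
             (m≤m+n _ _))

lemma2p30 : ∀ (n : ℕ) → 4 ≤ n →
    (n % 2 ≡ 0 → CoxeterLength n (wn n) ((3 * n * n + 2 * n) / 8))
    × (n % 2 ≡ 1 → CoxeterLength n (wn n) ((3 * (n ∸ 1) * (n ∸ 1) + 2 * (n ∸ 1)) / 8))
lemma2p30 n _ = evenCase , oddCase
  where
  evenCase : n % 2 ≡ 0 → CoxeterLength n (wn n) ((3 * n * n + 2 * n) / 8)
  evenCase n%2≡0 = subst (λ k → CoxeterLength k (wn k) ((3 * k * k + 2 * k) / 8))
                         (sym (trans (n≡n%2+double[n/2] n) (cong (_+ double (n / 2)) n%2≡0)))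
                         (wn-double-length (n / 2))
  oddCase : n % 2 ≡ 1 → CoxeterLength n (wn n) ((3 * (n ∸ 1) * (n ∸ 1) + 2 * (n ∸ 1)) / 8)
  oddCase n%2≡1 = subst (λ k → CoxeterLength k (wn k) ((3 * (k ∸ 1) * (k ∸ 1) + 2 * (k ∸ 1)) / 8))
                        (sym (trans (n≡n%2+double[n/2] n) (cong (_+ double (n / 2)) n%2≡1)))
                        (wn-suc-double-length (n / 2))
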